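{- Let $B_2=\{312,321,1342\}$. For every positive integer $n$ and every nonnegative integer $k$, the number of permutations in $\operatorname{Av}_n(B_2)$ with exactly $k$ inversions is $$\sum_{\ell=1}^{n}\binom{n-k-1}{k-\ell+1}.$$
   Context: $\operatorname{Av}_n(S)$ is the set of permutations of length $n$ avoiding every pattern in $S$ (classical pattern avoidance). An inversion of a permutation $\pi$ is a pair of positions $i<j$ with $\pi_i>\pi_j$. Binomial coefficients $\binom{a}{b}$ with integer arguments are taken to be $0$ unless $0\le b\le a$. -}

module Defs where

open import Data.Nat using (ℕ; zero; suc; _+_; _<_; _<?_)
open import Data.Nat.Combinatorics using (_C_)
open import Data.Integer using (ℤ; +_; -[1+_])
open import Data.List using (List; []; _∷_; length; lookup; filter; map; upTo)
open import Data.List.Relation.Binary.Permutation.Propositional using (_↭_)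
open import Data.List.Relation.Binary.Sublist.Propositional using (_⊆_)
open import Data.List.Relation.Unary.All using (All)
open import Data.List.Relation.Unary.Unique.Propositional using (Unique)
open import Data.List.Membership.Propositional using (_∈_)
open import Data.Fin using (Fin; cast)
open import Data.Product using (Σ; _×_; ∃)
open import Function.Bundles using (_⇔_)
open import Relation.Binary.PropositionalEquality using (_≡_)
open import Relation.Nullary using (¬_)

-- A permutation of length n, in one-line notation, is a list that is a
-- rearrangement of 0,1,...,n-1 (values shifted down by one from 1..n).
IsPerm : ℕ → List ℕ → Set
IsPerm n π = π ↭ upTo n

OrderIso : List ℕ → List ℕ → Set
OrderIso τ σ = Σ (length τ ≡ length σ) λ eq →
  (i j : Fin (length τ)) →
    (lookup τ i < lookup τ j) ⇔ (lookup σ (cast eq i) < lookup σ (cast eq j))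

Contains : List ℕ → List ℕ → Set
Contains π σ = ∃ λ τ → (τ ⊆ π) × OrderIso τ σ

Avoids : List ℕ → List (List ℕ) → Set
Avoids π S = All (λ σ → ¬ Contains π σ) S

inv : List ℕ → ℕ
inv []       = 0
inv (x ∷ xs) = length (filter (_<? x) xs) + inv xs

B₂ : List (List ℕ)
B₂ = (3 ∷ 1 ∷ 2 ∷ []) ∷ (3 ∷ 2 ∷ 1 ∷ []) ∷ (1 ∷ 3 ∷ 4 ∷ 2 ∷ []) ∷ []

-- binomial coefficient with integer arguments, 0 unless 0 ≤ b ≤ a
binomℤ : ℤ → ℤ → ℕ
binomℤ (+ a)    (+ b)    = a C b
binomℤ (+ a)    -[1+ _ ] = 0
binomℤ -[1+ _ ] _        = 0

-- "the number of elements of P is N": a duplicate-free list of exactly the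
-- elements satisfying P, of length N
HasCount : (P : List ℕ → Set) → ℕ → Set
HasCount P N = ∃ λ L → Unique L × ((π : List ℕ) → (π ∈ L ⇔ P π)) × (length L ≡ N)

module Submission where

-- Read as permutations of 0, …, n − 1, a permutation avoids 312 and 321 exactly when no
-- entry has two smaller entries after it, i.e. its Lehmer code takes values in {0, 1}. Avoiding 1342
-- as well forces the shape 1, 2, …, j, 0, T, where T is a permutation of j + 1, …, n − 1 built from
-- fixed points and adjacent transpositions: a tiling of n − 1 − j cells by monominoes and dominoes.
-- Such a permutation has j + (number of dominoes) inversions, and the tilings of N cells with t
-- dominoes number C(N − t, t), so the count is Σ_{j<n} C(n − 1 − k, k − j); here ℓ = j + 1.

open import Defs

open import Data.Bool using (T)
open import Data.Empty using (⊥; ⊥-elim)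
open import Data.Fin using (Fin; zero; suc; cast; toℕ; #_)
open import Data.Fin.Properties using (toℕ-injective; toℕ-cast)
open import Data.Integer using (ℤ; +_; -[1+_]; -_; _-_) renaming (_+_ to _+ℤ_)
import Data.Integer as ℤ
open import Data.Integer.Properties using (m-n≡m⊖n; ⊖-≥; ⊖-<)
open import Data.Integer.Tactic.RingSolver using (solve-∀)
open import Data.List using (List; []; _∷_; _++_; length; lookup; filter; map; upTo; applyUpTo; replicate)
open import Data.List.Membership.Propositional using (_∈_)
open import Data.List.Membership.Propositional.Properties
  using (∈-lookup; ∈-upTo⁺; ∈-upTo⁻; ∈-map⁺; ∈-map⁻; ∈-++⁺ˡ; ∈-++⁺ʳ; ∈-++⁻)
open import Data.List.Properties
  using (map-cong-local; length-upTo; length-map; length-++; ∷-injectiveʳ;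
         filter-none; filter-accept; filter-all; filter-reject; filter-++)
open import Data.List.Relation.Binary.Permutation.Propositional
  using (_↭_; prep; swap; ↭-refl; ↭-sym; ↭⇒↭ₛ; module PermutationReasoning)
open import Data.List.Relation.Binary.Permutation.Propositional.Properties using (shift; ++⁺ˡ; ↭-length; ∈-resp-↭)
open import Data.List.Relation.Binary.Sublist.Propositional using (_⊆_; []; _∷_; _∷ʳ_; ⊆-refl; ⊆-trans; from∈)
open import Data.List.Relation.Binary.Sublist.Propositional.Properties
  using (All-resp-⊆; filter⁺; filter-⊆; length-mono-≤) renaming (++⁺ˡ to ⊆-++⁺ˡ)
open import Data.List.Relation.Unary.All using (All; []; _∷_)
import Data.List.Relation.Unary.All as All
open import Data.List.Relation.Unary.All.Properties using (replicate⁺; all-filter) renaming (++⁺ to All-++⁺)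
open import Data.List.Relation.Unary.AllPairs using ([]; _∷_)
open import Data.List.Relation.Unary.Any using (here; there)
open import Data.List.Relation.Unary.Unique.Propositional using (Unique)
open import Data.List.Relation.Unary.Unique.Propositional.Properties using (upTo⁺; map⁺; ++⁺)
open import Data.Nat using (ℕ; zero; suc; _+_; _∸_; _≤_; _<_; _<ᵇ_; z≤n; s≤s; _<?_; _≟_; _≤?_)
open import Data.Nat.Combinatorics using (_C_; k>n⇒nCk≡0; nCk+nC[k+1]≡[n+1]C[k+1])
open import Data.Nat.ListAction using (sum)
open import Data.Nat.ListAction.Properties using (sum-++)
open import Data.Nat.Properties
open import Data.Product using (_×_; _,_; ∃; ∃₂; proj₁; proj₂; uncurry)
import Data.Product as Product
open import Data.Product.Properties using (,-injectiveˡ; ,-injectiveʳ)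
open import Data.Sum using (_⊎_; inj₁; inj₂)
import Data.Sum as Sum
open import Data.Unit using (tt)
open import Function using (id; _∘_; case_of_)
open import Function.Bundles using (_⇔_; mk⇔; Equivalence)
open import Relation.Binary.Definitions using (tri<; tri≈; tri>)
open import Relation.Binary.PropositionalEquality
  using (_≡_; _≢_; refl; sym; trans; cong; cong₂; subst; subst₂; ≢-sym; setoid; module ≡-Reasoning)
open import Data.List.Relation.Binary.Permutation.Setoid.Properties (setoid ℕ) using (Unique-resp-↭)
open import Data.List.Relation.Unary.Unique.DecPropositional _≟_ using (unique?)
open import Relation.Nullary using (¬_; yes; no)
open import Relation.Nullary.Decidable using (from-yes)
-- Tilings and the canonical permutations

data Tile : Set where
  mono domino : Tile

cells : List Tile → ℕ
cells []           = 0
cells (mono ∷ w)   = suc (cells w)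
cells (domino ∷ w) = suc (suc (cells w))

dominoes : List Tile → ℕ
dominoes []           = 0
dominoes (mono ∷ w)   = dominoes w
dominoes (domino ∷ w) = suc (dominoes w)

ascending : ℕ → ℕ → List ℕ
ascending a zero    = []
ascending a (suc j) = a ∷ ascending (suc a) j

tiling : ℕ → List Tile → List ℕ
tiling o []           = []
tiling o (mono ∷ w)   = o ∷ tiling (suc o) w
tiling o (domino ∷ w) = suc o ∷ o ∷ tiling (suc (suc o)) w

canonical : ℕ → List Tile → List ℕ
canonical j w = ascending 1 j ++ 0 ∷ tiling (suc j) w

ascending-lowerBound : ∀ a j → All (a ≤_) (ascending a j)
ascending-lowerBound a zero    = []
ascending-lowerBound a (suc j) = ≤-refl ∷ All.map <⇒≤ (ascending-lowerBound (suc a) j)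

tiling-lowerBound : ∀ o w → All (o ≤_) (tiling o w)
tiling-lowerBound o []           = []
tiling-lowerBound o (mono ∷ w)   = ≤-refl ∷ All.map <⇒≤ (tiling-lowerBound (suc o) w)
tiling-lowerBound o (domino ∷ w) =
  n≤1+n o ∷ ≤-refl ∷ All.map (≤-trans (n≤1+n o) ∘ <⇒≤) (tiling-lowerBound (suc (suc o)) w)

ascending-++ : ∀ a j s → ascending a (j + s) ≡ ascending a j ++ ascending (a + j) s
ascending-++ a zero    s = cong (λ b → ascending b s) (sym (+-identityʳ a))
ascending-++ a (suc j) s = cong (a ∷_) (trans (ascending-++ (suc a) j s)
  (cong (λ b → ascending (suc a) j ++ ascending b s) (sym (+-suc a j))))

ascending-snoc : ∀ a j (ρ : List ℕ) → ascending a j ++ (a + j) ∷ ρ ≡ ascending a (suc j) ++ ρ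
ascending-snoc a zero    ρ = cong (_∷ ρ) (+-identityʳ a)
ascending-snoc a (suc j) ρ = cong (a ∷_) (trans (cong (λ b → ascending (suc a) j ++ b ∷ ρ) (+-suc a j))
  (ascending-snoc (suc a) j ρ))

applyUpTo≡ascending : ∀ a n (f : ℕ → ℕ) → (∀ x → f x ≡ a + x) → applyUpTo f n ≡ ascending a n
applyUpTo≡ascending a zero    f f≗a+ = refl
applyUpTo≡ascending a (suc n) f f≗a+ = cong₂ _∷_ (trans (f≗a+ 0) (+-identityʳ a))
  (applyUpTo≡ascending (suc a) n (f ∘ suc) (λ x → trans (f≗a+ (suc x)) (+-suc a x)))

tiling-↭ : ∀ o w → tiling o w ↭ ascending o (cells w)
tiling-↭ o []           = ↭-refl
tiling-↭ o (mono ∷ w)   = prep o (tiling-↭ (suc o) w)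
tiling-↭ o (domino ∷ w) = swap (suc o) o (tiling-↭ (suc (suc o)) w)

canonical-↭ : ∀ j w → canonical j w ↭ upTo (suc j + cells w)
canonical-↭ j w = begin
  ascending 1 j ++ 0 ∷ tiling (suc j) w             ↭⟨ shift 0 (ascending 1 j) _ ⟩
  0 ∷ ascending 1 j ++ tiling (suc j) w             ↭⟨ prep 0 (++⁺ˡ (ascending 1 j) (tiling-↭ (suc j) w)) ⟩
  0 ∷ ascending 1 j ++ ascending (suc j) (cells w)  ≡⟨ cong (0 ∷_) (ascending-++ 1 j (cells w)) ⟨
  ascending 0 (suc j + cells w)                     ≡⟨ applyUpTo≡ascending 0 _ id (λ _ → refl) ⟨
  upTo (suc j + cells w)                            ∎
  where open PermutationReasoning

length-canonical : ∀ j w → length (canonical j w) ≡ suc j + cells w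
length-canonical j w = trans (↭-length (canonical-↭ j w)) (length-upTo _)

-- Inversions through the Lehmer code

lehmer : List ℕ → List ℕ
lehmer []       = []
lehmer (x ∷ xs) = length (filter (_<? x) xs) ∷ lehmer xs

sum-lehmer : ∀ π → sum (lehmer π) ≡ inv π
sum-lehmer []       = refl
sum-lehmer (x ∷ xs) = cong₂ _+_ refl (sum-lehmer xs)

filter-<-none : ∀ {x ys} → All (x ≤_) ys → filter (_<? x) ys ≡ []
filter-<-none x≤ys = filter-none (_<? _) (All.map ≤⇒≯ x≤ys)

filter-<-single : ∀ {x z} ys {zs} → All (x ≤_) ys → z < x → All (x ≤_) zs →
  filter (_<? x) (ys ++ z ∷ zs) ≡ z ∷ []
filter-<-single {x} ys {zs} x≤ys z<x x≤zs = begin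
  filter (_<? x) (ys ++ _ ∷ zs)                 ≡⟨ filter-++ (_<? x) ys _ ⟩
  filter (_<? x) ys ++ filter (_<? x) (_ ∷ zs)  ≡⟨ cong₂ _++_ (filter-<-none x≤ys) (filter-accept (_<? x) z<x) ⟩
  _ ∷ filter (_<? x) zs                         ≡⟨ cong (_ ∷_) (filter-<-none x≤zs) ⟩
  _ ∷ []                                        ∎
  where open ≡-Reasoning

tileCode : List Tile → List ℕ
tileCode []           = []
tileCode (mono ∷ w)   = 0 ∷ tileCode w
tileCode (domino ∷ w) = 1 ∷ 0 ∷ tileCode w

lehmer-tiling : ∀ o w → lehmer (tiling o w) ≡ tileCode w
lehmer-tiling o []           = refl
lehmer-tiling o (mono ∷ w)   = cong₂ _∷_
  (cong length (filter-<-none (All.map <⇒≤ (tiling-lowerBound (suc o) w))))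
  (lehmer-tiling (suc o) w)
lehmer-tiling o (domino ∷ w) = cong₂ _∷_
  (cong length (filter-<-single [] [] ≤-refl (All.map <⇒≤ above)))
  (cong₂ _∷_ (cong length (filter-<-none (All.map (<⇒≤ ∘ <-trans (n<1+n o)) above)))
    (lehmer-tiling (suc (suc o)) w))
  where
  above : All (suc o <_) (tiling (suc (suc o)) w)
  above = tiling-lowerBound (suc (suc o)) w

lehmer-block : ∀ a j L → 0 < a → All (a + j ≤_) L →
  lehmer (ascending a j ++ 0 ∷ L) ≡ replicate j 1 ++ 0 ∷ lehmer L
lehmer-block a zero    L 0<a a+j≤L =
  cong (_∷ lehmer L) (cong length (filter-<-none (All.map (λ _ → z≤n) a+j≤L)))
lehmer-block a (suc j) L 0<a a+j≤L = cong₂ _∷_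
  (cong length (filter-<-single (ascending (suc a) j) (All.map <⇒≤ (ascending-lowerBound (suc a) j)) 0<a
    (All.map (≤-trans (m≤m+n a (suc j))) a+j≤L)))
  (lehmer-block (suc a) j L (<-trans 0<a (n<1+n a)) (subst (λ b → All (b ≤_) L) (+-suc a j) a+j≤L))

lehmer-canonical : ∀ j w → lehmer (canonical j w) ≡ replicate j 1 ++ 0 ∷ tileCode w
lehmer-canonical j w = trans (lehmer-block 1 j (tiling (suc j) w) (s≤s z≤n) (tiling-lowerBound (suc j) w))
  (cong (λ c → replicate j 1 ++ 0 ∷ c) (lehmer-tiling (suc j) w))

sum-replicate-1 : ∀ j → sum (replicate j 1) ≡ j
sum-replicate-1 zero    = refl
sum-replicate-1 (suc j) = cong suc (sum-replicate-1 j)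

sum-tileCode : ∀ w → sum (tileCode w) ≡ dominoes w
sum-tileCode []           = refl
sum-tileCode (mono ∷ w)   = sum-tileCode w
sum-tileCode (domino ∷ w) = cong suc (sum-tileCode w)

inv-canonical : ∀ j w → inv (canonical j w) ≡ j + dominoes w
inv-canonical j w = begin
  inv (canonical j w)                     ≡⟨ sum-lehmer (canonical j w) ⟨
  sum (lehmer (canonical j w))            ≡⟨ cong sum (lehmer-canonical j w) ⟩
  sum (replicate j 1 ++ 0 ∷ tileCode w)   ≡⟨ sum-++ (replicate j 1) _ ⟩
  sum (replicate j 1) + sum (tileCode w)  ≡⟨ cong₂ _+_ (sum-replicate-1 j) (sum-tileCode w) ⟩
  j + dominoes w                          ∎
  where open ≡-Reasoning

NoTwoSmallerAfter : List ℕ → Set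
NoTwoSmallerAfter π = ∀ a b c → (a ∷ b ∷ c ∷ []) ⊆ π → b < a → c < a → ⊥

No231 : List ℕ → Set
No231 π = ∀ b c d → (b ∷ c ∷ d ∷ []) ⊆ π → d < b → b < c → ⊥

No1342 : List ℕ → Set
No1342 π = ∀ a b c d → (a ∷ b ∷ c ∷ d ∷ []) ⊆ π → a < d → d < b → b < c → ⊥

NoTwoSmallerAfter-⊆ : ∀ {τ π} → τ ⊆ π → NoTwoSmallerAfter π → NoTwoSmallerAfter τ
NoTwoSmallerAfter-⊆ τ⊆π free a b c p = free a b c (⊆-trans p τ⊆π)

No231-⊆ : ∀ {τ π} → τ ⊆ π → No231 π → No231 τ
No231-⊆ τ⊆π no231 b c d p = no231 b c d (⊆-trans p τ⊆π)

No1342-⊆ : ∀ {τ π} → τ ⊆ π → No1342 π → No1342 τ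
No1342-⊆ τ⊆π no1342 a b c d p = no1342 a b c d (⊆-trans p τ⊆π)

lehmer≤1⇒noTwoSmallerAfter : ∀ {π} → All (_≤ 1) (lehmer π) → NoTwoSmallerAfter π
lehmer≤1⇒noTwoSmallerAfter (_ ∷ ≤1) a b c (_ ∷ʳ p) = lehmer≤1⇒noTwoSmallerAfter ≤1 a b c p
lehmer≤1⇒noTwoSmallerAfter {x ∷ xs} (≤1 ∷ _) .x b c (refl ∷ p) b<x c<x = ≤⇒≯ ≤1 (begin
  2                                        ≡⟨ cong length (filter-all (_<? x) (b<x ∷ c<x ∷ [])) ⟨
  length (filter (_<? x) (b ∷ c ∷ []))     ≤⟨ length-mono-≤ (filter⁺ (_<? x) (_<? x) (λ { refl → id }) p) ⟩
  length (filter (_<? x) xs)               ∎)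
  where open ≤-Reasoning

tileCode≤1 : ∀ w → All (_≤ 1) (tileCode w)
tileCode≤1 []           = []
tileCode≤1 (mono ∷ w)   = z≤n ∷ tileCode≤1 w
tileCode≤1 (domino ∷ w) = ≤-refl ∷ z≤n ∷ tileCode≤1 w

canonical-noTwoSmallerAfter : ∀ j w → NoTwoSmallerAfter (canonical j w)
canonical-noTwoSmallerAfter j w = lehmer≤1⇒noTwoSmallerAfter
  (subst (All (_≤ 1)) (sym (lehmer-canonical j w)) (All-++⁺ (replicate⁺ j ≤-refl) (z≤n ∷ tileCode≤1 w)))

No231-∷ : ∀ {x xs} → (∀ c d → (c ∷ d ∷ []) ⊆ xs → d < x → x < c → ⊥) → No231 xs → No231 (x ∷ xs)
No231-∷ no231-from-x no231 b c d (_ ∷ʳ p)   = no231 b c d p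
No231-∷ no231-from-x no231 b c d (refl ∷ p) = no231-from-x c d p

No231-∷-min : ∀ {x xs} → All (x ≤_) xs → No231 xs → No231 (x ∷ xs)
No231-∷-min x≤xs = No231-∷ λ c d p d<x _ →
  case All-resp-⊆ p x≤xs of λ { (_ ∷ x≤d ∷ []) → <⇒≱ d<x x≤d }

tiling-no231 : ∀ o w → No231 (tiling o w)
tiling-no231 o []           _ _ _ ()
tiling-no231 o (mono ∷ w)   =
  No231-∷-min (All.map <⇒≤ (tiling-lowerBound (suc o) w)) (tiling-no231 (suc o) w)
tiling-no231 o (domino ∷ w) =
  No231-∷ partner (No231-∷-min (All.map (<⇒≤ ∘ <-trans (n<1+n o)) above) (tiling-no231 (suc (suc o)) w))
  where
  above : All (suc o <_) (tiling (suc (suc o)) w)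
  above = tiling-lowerBound (suc (suc o)) w
  partner : ∀ c d → (c ∷ d ∷ []) ⊆ o ∷ tiling (suc (suc o)) w → d < suc o → suc o < c → ⊥
  partner c d (refl ∷ _) _ so<o = <-asym so<o (n<1+n o)
  partner c d (_ ∷ʳ p) d<so _ = case All-resp-⊆ p above of λ { (_ ∷ so<d ∷ []) → <-asym d<so so<d }

ascending-no231 : ∀ a j L → All (a + j ≤_) L → No231 L → No231 (ascending a j ++ L)
ascending-no231 a zero    L a+j≤L no231 = no231
ascending-no231 a (suc j) L a+j≤L no231 = No231-∷-min
  (All-++⁺ (All.map <⇒≤ (ascending-lowerBound (suc a) j)) (All.map (≤-trans (m≤m+n a (suc j))) a+j≤L))
  (ascending-no231 (suc a) j L (subst (λ b → All (b ≤_) L) (+-suc a j) a+j≤L) no231)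

No231⇒No1342 : ∀ {π} → No231 π → No1342 π
No231⇒No1342 no231 a b c d p _ = no231 b c d (⊆-trans (_ ∷ʳ ⊆-refl) p)

-- 1342 is 1 ⊕ 231: the entries of a 1342 after its 1 form a 231 lying above it.
No1342-∷ : ∀ {x xs} → No231 (filter (x <?_) xs) → No1342 xs → No1342 (x ∷ xs)
No1342-∷ no231 no1342 a b c d (_ ∷ʳ p) = no1342 a b c d p
No1342-∷ {x} no231 no1342 .x b c d (refl ∷ p) x<d d<b b<c = no231 b c d
  (subst (_⊆ _) (filter-all (x <?_) (<-trans x<d d<b ∷ <-trans (<-trans x<d d<b) b<c ∷ x<d ∷ []))
    (filter⁺ (x <?_) (x <?_) (λ { refl → id }) p))
  d<b b<c

No1342-∷⁻ : ∀ {x xs} → No1342 (x ∷ xs) → No231 (filter (x <?_) xs)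
No1342-∷⁻ {x} {xs} no1342 b c d p d<b b<c = case All-resp-⊆ p (all-filter (x <?_) xs) of λ
  { (_ ∷ _ ∷ x<d ∷ []) → no1342 x b c d (refl ∷ ⊆-trans p (filter-⊆ (x <?_) xs)) x<d d<b b<c }

No1342⇒No231-above : ∀ xs {x ρ} → No1342 (xs ++ x ∷ ρ) → All (x <_) ρ → No231 ρ
No1342⇒No231-above xs {x} no1342 x<ρ =
  subst No231 (filter-all (x <?_) x<ρ) (No1342-∷⁻ (No1342-⊆ (⊆-++⁺ˡ xs ⊆-refl) no1342))

block-no1342 : ∀ a j L → 0 < a → All (a + j ≤_) L → No231 L → No1342 (ascending a j ++ 0 ∷ L)
block-no1342 a zero    L 0<a a+j≤L no231 = No1342-∷
  (subst No231 (sym (filter-all (0 <?_) (All.map (<-≤-trans 0<a ∘ ≤-trans (m≤m+n a 0)) a+j≤L))) no231)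
  (No231⇒No1342 no231)
block-no1342 a (suc j) L 0<a a+j≤L no231 = No1342-∷
  (subst No231 (sym above-a) (ascending-no231 (suc a) j L [1+a]+j≤L no231))
  (block-no1342 (suc a) j L (<-trans 0<a (n<1+n a)) [1+a]+j≤L no231)
  where
  [1+a]+j≤L : All (suc a + j ≤_) L
  [1+a]+j≤L = subst (λ b → All (b ≤_) L) (+-suc a j) a+j≤L
  above-a : filter (a <?_) (ascending (suc a) j ++ 0 ∷ L) ≡ ascending (suc a) j ++ L
  above-a = begin
    filter (a <?_) (ascending (suc a) j ++ 0 ∷ L)
      ≡⟨ filter-++ (a <?_) (ascending (suc a) j) _ ⟩
    filter (a <?_) (ascending (suc a) j) ++ filter (a <?_) (0 ∷ L)
      ≡⟨ cong₂ _++_ (filter-all (a <?_) (ascending-lowerBound (suc a) j)) (filter-reject (a <?_) {0} {L} λ ()) ⟩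
    ascending (suc a) j ++ filter (a <?_) L
      ≡⟨ cong (ascending (suc a) j ++_) (filter-all (a <?_) (All.map (≤-trans (m≤m+n (suc a) j)) [1+a]+j≤L)) ⟩
    ascending (suc a) j ++ L
      ∎
    where open ≡-Reasoning

canonical-no1342 : ∀ j w → No1342 (canonical j w)
canonical-no1342 j w =
  block-no1342 1 j (tiling (suc j) w) (s≤s z≤n) (tiling-lowerBound (suc j) w) (tiling-no231 (suc j) w)

Unique⇒lookup-injective : ∀ {xs : List ℕ} → Unique xs → ∀ i j → lookup xs i ≡ lookup xs j → i ≡ j
Unique⇒lookup-injective (_  ∷ _) zero    zero    _  = refl
Unique⇒lookup-injective (x∉ ∷ _) zero    (suc j) x≡ = ⊥-elim (All.lookup x∉ (∈-lookup j) x≡)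
Unique⇒lookup-injective (x∉ ∷ _) (suc i) zero    ≡x = ⊥-elim (All.lookup x∉ (∈-lookup i) (sym ≡x))
Unique⇒lookup-injective (_  ∷ u) (suc i) (suc j) eq = cong suc (Unique⇒lookup-injective u i j eq)

cast-injective : ∀ {m n} .(eq : m ≡ n) {i j : Fin m} → cast eq i ≡ cast eq j → i ≡ j
cast-injective eq {i} {j} e = toℕ-injective (trans (sym (toℕ-cast eq i)) (trans (cong toℕ e) (toℕ-cast eq j)))

OrderPreserving : (τ σ : List ℕ) → length τ ≡ length σ → Set
OrderPreserving τ σ eq = ∀ i j → T (lookup σ (cast eq i) <ᵇ lookup σ (cast eq j)) → lookup τ i < lookup τ j

-- Reflection of the order comes for free when σ has no repeated entries.
orderIso : ∀ {τ σ} (eq : length τ ≡ length σ) → Unique σ → OrderPreserving τ σ eq → OrderIso τ σ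
orderIso {τ} {σ} eq uσ preserves = eq , λ i j → mk⇔ (reflects i j) (preserves i j ∘ <⇒<ᵇ)
  where
  reflects : ∀ i j → lookup τ i < lookup τ j → lookup σ (cast eq i) < lookup σ (cast eq j)
  reflects i j τi<τj with <-cmp (lookup σ (cast eq i)) (lookup σ (cast eq j))
  ... | tri< σi<σj _ _ = σi<σj
  ... | tri≈ _ σi≡σj _ =
    ⊥-elim (<-irrefl (cong (lookup τ) (cast-injective eq (Unique⇒lookup-injective uσ _ _ σi≡σj))) τi<τj)
  ... | tri> _ _ σj<σi = ⊥-elim (<-asym τi<τj (preserves j i (<⇒<ᵇ σj<σi)))

contains312 : ∀ {π a b c} → (a ∷ b ∷ c ∷ []) ⊆ π → b < c → c < a → Contains π (3 ∷ 1 ∷ 2 ∷ [])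
contains312 {a = a} {b} {c} p b<c c<a = _ , p , orderIso refl (from-yes (unique? (3 ∷ 1 ∷ 2 ∷ []))) preserves
  where
  preserves : OrderPreserving (a ∷ b ∷ c ∷ []) (3 ∷ 1 ∷ 2 ∷ []) refl
  preserves zero             zero             ()
  preserves zero             (suc zero)       ()
  preserves zero             (suc (suc zero)) ()
  preserves (suc zero)       zero             _  = <-trans b<c c<a
  preserves (suc zero)       (suc zero)       ()
  preserves (suc zero)       (suc (suc zero)) _  = b<c
  preserves (suc (suc zero)) zero             _  = c<a
  preserves (suc (suc zero)) (suc zero)       ()
  preserves (suc (suc zero)) (suc (suc zero)) ()

contains321 : ∀ {π a b c} → (a ∷ b ∷ c ∷ []) ⊆ π → c < b → b < a → Contains π (3 ∷ 2 ∷ 1 ∷ [])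
contains321 {a = a} {b} {c} p c<b b<a = _ , p , orderIso refl (from-yes (unique? (3 ∷ 2 ∷ 1 ∷ []))) preserves
  where
  preserves : OrderPreserving (a ∷ b ∷ c ∷ []) (3 ∷ 2 ∷ 1 ∷ []) refl
  preserves zero             zero             ()
  preserves zero             (suc zero)       ()
  preserves zero             (suc (suc zero)) ()
  preserves (suc zero)       zero             _  = b<a
  preserves (suc zero)       (suc zero)       ()
  preserves (suc zero)       (suc (suc zero)) ()
  preserves (suc (suc zero)) zero             _  = <-trans c<b b<a
  preserves (suc (suc zero)) (suc zero)       _  = c<b
  preserves (suc (suc zero)) (suc (suc zero)) ()

contains1342 : ∀ {π a b c d} → (a ∷ b ∷ c ∷ d ∷ []) ⊆ π → a < d → d < b → b < c →
  Contains π (1 ∷ 3 ∷ 4 ∷ 2 ∷ [])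
contains1342 {a = a} {b} {c} {d} p a<d d<b b<c =
  _ , p , orderIso refl (from-yes (unique? (1 ∷ 3 ∷ 4 ∷ 2 ∷ []))) preserves
  where
  preserves : OrderPreserving (a ∷ b ∷ c ∷ d ∷ []) (1 ∷ 3 ∷ 4 ∷ 2 ∷ []) refl
  preserves zero                   zero                   ()
  preserves zero                   (suc zero)             _  = <-trans a<d d<b
  preserves zero                   (suc (suc zero))       _  = <-trans (<-trans a<d d<b) b<c
  preserves zero                   (suc (suc (suc zero))) _  = a<d
  preserves (suc zero)             zero                   ()
  preserves (suc zero)             (suc zero)             ()
  preserves (suc zero)             (suc (suc zero))       _  = b<c
  preserves (suc zero)             (suc (suc (suc zero))) ()
  preserves (suc (suc zero))       zero                   ()
  preserves (suc (suc zero))       (suc zero)             ()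
  preserves (suc (suc zero))       (suc (suc zero))       ()
  preserves (suc (suc zero))       (suc (suc (suc zero))) ()
  preserves (suc (suc (suc zero))) zero                   ()
  preserves (suc (suc (suc zero))) (suc zero)             _  = d<b
  preserves (suc (suc (suc zero))) (suc (suc zero))       _  = <-trans d<b b<c
  preserves (suc (suc (suc zero))) (suc (suc (suc zero))) ()

noTwoSmallerAfter⇒¬Contains-maxFirst : ∀ {π x y z} → NoTwoSmallerAfter π → T (y <ᵇ x) → T (z <ᵇ x) →
  ¬ Contains π (x ∷ y ∷ z ∷ [])
noTwoSmallerAfter⇒¬Contains-maxFirst free y<x z<x ((a ∷ b ∷ c ∷ []) , p , refl , iso) = free a b c p
  (Equivalence.from (iso (# 1) (# 0)) (<ᵇ⇒< _ _ y<x)) (Equivalence.from (iso (# 2) (# 0)) (<ᵇ⇒< _ _ z<x))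
noTwoSmallerAfter⇒¬Contains-maxFirst _ _ _ ([]                  , _ , () , _)
noTwoSmallerAfter⇒¬Contains-maxFirst _ _ _ ((_ ∷ [])            , _ , () , _)
noTwoSmallerAfter⇒¬Contains-maxFirst _ _ _ ((_ ∷ _ ∷ [])        , _ , () , _)
noTwoSmallerAfter⇒¬Contains-maxFirst _ _ _ ((_ ∷ _ ∷ _ ∷ _ ∷ _) , _ , () , _)

no1342⇒¬Contains1342 : ∀ {π} → No1342 π → ¬ Contains π (1 ∷ 3 ∷ 4 ∷ 2 ∷ [])
no1342⇒¬Contains1342 no1342 ((a ∷ b ∷ c ∷ d ∷ []) , p , refl , iso) =
  no1342 a b c d p (from (# 0) (# 3)) (from (# 3) (# 1)) (from (# 1) (# 2))
  where
  σ τ : List ℕ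
  σ = 1 ∷ 3 ∷ 4 ∷ 2 ∷ []
  τ = a ∷ b ∷ c ∷ d ∷ []
  from : ∀ i j {σi<σj : T (lookup σ (cast refl i) <ᵇ lookup σ (cast refl j))} → lookup τ i < lookup τ j
  from i j {σi<σj} = Equivalence.from (iso i j) (<ᵇ⇒< _ _ σi<σj)
no1342⇒¬Contains1342 _ ([]                      , _ , () , _)
no1342⇒¬Contains1342 _ ((_ ∷ [])                , _ , () , _)
no1342⇒¬Contains1342 _ ((_ ∷ _ ∷ [])            , _ , () , _)
no1342⇒¬Contains1342 _ ((_ ∷ _ ∷ _ ∷ [])        , _ , () , _)
no1342⇒¬Contains1342 _ ((_ ∷ _ ∷ _ ∷ _ ∷ _ ∷ _) , _ , () , _)

canonical-avoids : ∀ j w → Avoids (canonical j w) B₂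
canonical-avoids j w =
  noTwoSmallerAfter⇒¬Contains-maxFirst free tt tt ∷
  noTwoSmallerAfter⇒¬Contains-maxFirst free tt tt ∷
  no1342⇒¬Contains1342 (canonical-no1342 j w) ∷ []
  where
  free : NoTwoSmallerAfter (canonical j w)
  free = canonical-noTwoSmallerAfter j w

⊆-unique : ∀ {τ xs : List ℕ} → τ ⊆ xs → Unique xs → Unique τ
⊆-unique []         []       = []
⊆-unique (_ ∷ʳ p)   (_ ∷ u)  = ⊆-unique p u
⊆-unique (refl ∷ p) (x∉ ∷ u) = All-resp-⊆ p x∉ ∷ ⊆-unique p u

avoids⇒noTwoSmallerAfter : ∀ {π} → Unique π → Avoids π B₂ → NoTwoSmallerAfter π
avoids⇒noTwoSmallerAfter u (¬312 ∷ ¬321 ∷ _) a b c p b<a c<a with <-cmp b c | ⊆-unique p u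
... | tri< b<c _ _ | _                   = ¬312 (contains312 p b<c c<a)
... | tri≈ _ b≡c _ | _ ∷ (b≢c ∷ []) ∷ _ = b≢c b≡c
... | tri> _ _ c<b | _                   = ¬321 (contains321 p c<b b<a)

avoids⇒no1342 : ∀ {π} → Avoids π B₂ → No1342 π
avoids⇒no1342 (_ ∷ _ ∷ ¬1342 ∷ []) a b c d p a<d d<b b<c = ¬1342 (contains1342 p a<d d<b b<c)

-- Every avoider is canonical

∈-tail : ∀ {z x : ℕ} {ρ} → z ∈ x ∷ ρ → z ≢ x → z ∈ ρ
∈-tail (here z≡x)  z≢x = ⊥-elim (z≢x z≡x)
∈-tail (there z∈ρ) _   = z∈ρ

members⇒⊆ : ∀ {p q : ℕ} {xs} → p ∈ xs → q ∈ xs → p ≢ q → (p ∷ q ∷ []) ⊆ xs ⊎ (q ∷ p ∷ []) ⊆ xs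
members⇒⊆ (here refl) (here refl) p≢q = ⊥-elim (p≢q refl)
members⇒⊆ (here refl) (there q∈)  _   = inj₁ (refl ∷ from∈ q∈)
members⇒⊆ (there p∈)  (here refl) _   = inj₂ (refl ∷ from∈ p∈)
members⇒⊆ (there p∈)  (there q∈)  p≢q = Sum.map (_ ∷ʳ_) (_ ∷ʳ_) (members⇒⊆ p∈ q∈ p≢q)

record Enumerates (P : ℕ → Set) (ρ : List ℕ) : Set where
  field
    unique   : Unique ρ
    members  : ∀ {z} → z ∈ ρ → P z
    complete : ∀ {z} → P z → z ∈ ρ
open Enumerates

Enumerates-↭ : ∀ {P xs ys} → xs ↭ ys → Enumerates P xs → Enumerates P ys
Enumerates-↭ xs↭ys e = record
  { unique   = Unique-resp-↭ (↭⇒↭ₛ xs↭ys) (unique e)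
  ; members  = members e ∘ ∈-resp-↭ (↭-sym xs↭ys)
  ; complete = ∈-resp-↭ xs↭ys ∘ complete e
  }

Enumerates-∷ : ∀ {P Q x ρ} → Enumerates P (x ∷ ρ) →
  (∀ {z} → Q z → P z × z ≢ x) → (∀ {z} → P z → z ≢ x → Q z) → Enumerates Q ρ
Enumerates-∷ e Q⇒P∖x P∖x⇒Q with unique e
... | x∉ρ ∷ u = record
  { unique   = u
  ; members  = λ z∈ρ → P∖x⇒Q (members e (there z∈ρ)) λ { refl → All.lookup x∉ρ z∈ρ refl }
  ; complete = λ Qz → let (Pz , z≢x) = Q⇒P∖x Qz in ∈-tail (complete e Pz) z≢x
  }

not-two-smaller-members : ∀ {P x ρ p q} → Enumerates P (x ∷ ρ) → NoTwoSmallerAfter (x ∷ ρ) →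
  P p → P q → p < q → q < x → ⊥
not-two-smaller-members {x = x} {p = p} e free Pp Pq p<q q<x
  with members⇒⊆ (∈-tail (complete e Pp) (<⇒≢ p<x)) (∈-tail (complete e Pq) (<⇒≢ q<x)) (<⇒≢ p<q)
  where
  p<x : p < x
  p<x = <-trans p<q q<x
... | inj₁ pq⊆ρ = free x _ _ (refl ∷ pq⊆ρ) (<-trans p<q q<x) q<x
... | inj₂ qp⊆ρ = free x _ _ (refl ∷ qp⊆ρ) q<x (<-trans p<q q<x)

InRange : ℕ → ℕ → ℕ → Set
InRange o n z = o ≤ z × z < n

-- The values still to be placed after the prefix 1, …, j of a canonical permutation.
Block : ℕ → ℕ → ℕ → Set
Block j n z = z ≡ 0 ⊎ InRange (suc j) n z

InRange-suc⇒ : ∀ {o n z} → InRange (suc o) n z → InRange o n z × z ≢ o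
InRange-suc⇒ (o<z , z<n) = (<⇒≤ o<z , z<n) , >⇒≢ o<z

InRange-suc⇐ : ∀ {o n z} → InRange o n z → z ≢ o → InRange (suc o) n z
InRange-suc⇐ (o≤z , z<n) z≢o = ≤∧≢⇒< o≤z (≢-sym z≢o) , z<n

Enumerates-InRange-∷ : ∀ {o n ρ} → Enumerates (InRange o n) (o ∷ ρ) → Enumerates (InRange (suc o) n) ρ
Enumerates-InRange-∷ e = Enumerates-∷ e InRange-suc⇒ InRange-suc⇐

Enumerates-Block-zero∷ : ∀ {j n ρ} → Enumerates (Block j n) (0 ∷ ρ) → Enumerates (InRange (suc j) n) ρ
Enumerates-Block-zero∷ e = Enumerates-∷ e
  (λ r → inj₂ r , >⇒≢ (≤-trans (s≤s z≤n) (proj₁ r)))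
  λ { (inj₁ z≡0) z≢0 → ⊥-elim (z≢0 z≡0) ; (inj₂ r) _ → r }

Enumerates-Block-suc∷ : ∀ {j n ρ} → Enumerates (Block j n) (suc j ∷ ρ) → Enumerates (Block (suc j) n) ρ
Enumerates-Block-suc∷ e = Enumerates-∷ e
  (λ { (inj₁ refl) → inj₁ refl , λ () ; (inj₂ r) → Product.map₁ inj₂ (InRange-suc⇒ r) })
  λ { (inj₁ z≡0) _ → inj₁ z≡0 ; (inj₂ r) z≢sj → inj₂ (InRange-suc⇐ r z≢sj) }

IsPerm⇒Enumerates-Block : ∀ {n π} → 1 ≤ n → IsPerm n π → Enumerates (Block 0 n) π
IsPerm⇒Enumerates-Block {n} 1≤n π↭ = record
  { unique   = Unique-resp-↭ (↭⇒↭ₛ (↭-sym π↭)) (upTo⁺ n)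
  ; members  = λ z∈π → below⇒Block (∈-upTo⁻ (∈-resp-↭ π↭ z∈π))
  ; complete = λ b → ∈-resp-↭ (↭-sym π↭) (∈-upTo⁺ (Block⇒below b))
  }
  where
  below⇒Block : ∀ {z} → z < n → Block 0 n z
  below⇒Block {zero}  _   = inj₁ refl
  below⇒Block {suc z} z<n = inj₂ (s≤s z≤n , z<n)
  Block⇒below : ∀ {z} → Block 0 n z → z < n
  Block⇒below (inj₁ refl)      = 1≤n
  Block⇒below (inj₂ (_ , z<n)) = z<n

tiling-head : ∀ {o n x ρ} → Enumerates (InRange o n) (x ∷ ρ) → NoTwoSmallerAfter (x ∷ ρ) → x ≡ o ⊎ x ≡ suc o
tiling-head {o} {x = x} e free with x ≟ o | x ≟ suc o
... | yes x≡o | _        = inj₁ x≡o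
... | no _    | yes x≡so = inj₂ x≡so
... | no x≢o  | no x≢so  =
  ⊥-elim (not-two-smaller-members e free (≤-refl , <-trans (n<1+n o) so<n) (n≤1+n o , so<n) (n<1+n o) so<x)
  where
  x∈ : InRange o _ x
  x∈ = members e (here refl)
  so<x : suc o < x
  so<x = ≤∧≢⇒< (≤∧≢⇒< (proj₁ x∈) (≢-sym x≢o)) (≢-sym x≢so)
  so<n : suc o < _
  so<n = <-trans so<x (proj₂ x∈)

block-head : ∀ {j n y ρ} → Enumerates (Block j n) (y ∷ ρ) → NoTwoSmallerAfter (y ∷ ρ) → y ≡ 0 ⊎ y ≡ suc j
block-head {j} {y = y} e free with members e (here refl) | y ≟ suc j
... | inj₁ y≡0          | _        = inj₁ y≡0
... | inj₂ _            | yes y≡sj = inj₂ y≡sj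
... | inj₂ (sj≤y , y<n) | no y≢sj  =
  ⊥-elim (not-two-smaller-members e free (inj₁ refl) (inj₂ (≤-refl , <-trans sj<y y<n)) (s≤s z≤n) sj<y)
  where
  sj<y : suc j < y
  sj<y = ≤∧≢⇒< sj≤y (≢-sym y≢sj)

-- Only o can follow o + 1: otherwise o + 1, y, o with y > o + 1 would be a 231.
domino-partner : ∀ {o n y ρ} → Enumerates (InRange o n) (suc o ∷ y ∷ ρ) → No231 (suc o ∷ y ∷ ρ) → y ≡ o
domino-partner {o} {y = y} {ρ} e no231 with y ≟ o | unique e
... | yes y≡o | _              = y≡o
... | no y≢o  | (so≢y ∷ _) ∷ _ = ⊥-elim (no231 (suc o) y o (refl ∷ refl ∷ from∈ o∈ρ) (n<1+n o) so<y)
  where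
  o∈ρ : o ∈ ρ
  o∈ρ with complete e (≤-refl , <-trans (n<1+n o) (proj₂ (members e (here refl))))
  ... | here ()
  ... | there (here o≡y)  = ⊥-elim (y≢o (sym o≡y))
  ... | there (there o∈ρ) = o∈ρ
  so<y : suc o < y
  so<y = ≤∧≢⇒< (≤∧≢⇒< (proj₁ (members e (there (here refl)))) (≢-sym y≢o)) so≢y

domino-alone : ∀ {o n} → ¬ Enumerates (InRange o n) (suc o ∷ [])
domino-alone {o} e with complete e (≤-refl , <-trans (n<1+n o) (proj₂ (members e (here refl))))
... | here ()
... | there ()

tiling-recognised : ∀ {o n} ρ → Enumerates (InRange o n) ρ → NoTwoSmallerAfter ρ → No231 ρ →
  ∃ λ w → ρ ≡ tiling o w
tiling-recognised []      _ _    _     = [] , refl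
tiling-recognised (x ∷ ρ) e free no231 with tiling-head e free
... | inj₁ refl = Product.map (mono ∷_) (cong (x ∷_)) (tiling-recognised ρ (Enumerates-InRange-∷ e)
  (NoTwoSmallerAfter-⊆ (x ∷ʳ ⊆-refl) free) (No231-⊆ (x ∷ʳ ⊆-refl) no231))
tiling-recognised (x ∷ [])    e free no231 | inj₂ refl = ⊥-elim (domino-alone e)
tiling-recognised (x ∷ y ∷ ρ) e free no231 | inj₂ refl with domino-partner e no231
... | refl = Product.map (domino ∷_) (cong (λ t → x ∷ y ∷ t))
  (tiling-recognised ρ (Enumerates-InRange-∷ (Enumerates-InRange-∷ (Enumerates-↭ (swap x y ↭-refl) e)))
    (NoTwoSmallerAfter-⊆ (x ∷ʳ y ∷ʳ ⊆-refl) free) (No231-⊆ (x ∷ʳ y ∷ʳ ⊆-refl) no231))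

block-recognised : ∀ j {n} ρ → Enumerates (Block j n) ρ → NoTwoSmallerAfter ρ → No1342 (ascending 1 j ++ ρ) →
  ∃₂ λ j′ w → ascending 1 j ++ ρ ≡ canonical j′ w
block-recognised j []      e _    _      = ⊥-elim (case complete e (inj₁ refl) of λ ())
block-recognised j (y ∷ ρ) e free no1342 with block-head e free
... | inj₁ refl = j , Product.map₂ (cong (λ t → ascending 1 j ++ 0 ∷ t))
  (tiling-recognised ρ e′ (NoTwoSmallerAfter-⊆ (y ∷ʳ ⊆-refl) free)
    (No1342⇒No231-above (ascending 1 j) no1342 (All.tabulate (≤-trans (s≤s z≤n) ∘ proj₁ ∘ members e′))))
  where
  e′ : Enumerates (InRange (suc j) _) ρ
  e′ = Enumerates-Block-zero∷ e
... | inj₂ refl = Product.map₂ (Product.map₂ (trans (ascending-snoc 1 j ρ)))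
  (block-recognised (suc j) ρ (Enumerates-Block-suc∷ e) (NoTwoSmallerAfter-⊆ (y ∷ʳ ⊆-refl) free)
    (subst No1342 (ascending-snoc 1 j ρ) no1342))

avoider⇒canonical : ∀ {n π} → 1 ≤ n → IsPerm n π → Avoids π B₂ → ∃₂ λ j w → π ≡ canonical j w
avoider⇒canonical 1≤n π↭ avoids =
  block-recognised 0 _ e (avoids⇒noTwoSmallerAfter (unique e) avoids) (avoids⇒no1342 avoids)
  where
  e : Enumerates (Block 0 _) _
  e = IsPerm⇒Enumerates-Block 1≤n π↭

-- Counting tilings

tilings : ℕ → ℕ → List (List Tile)
tilings zero          zero    = [] ∷ []
tilings zero          (suc t) = []
tilings (suc zero)    t       = map (mono ∷_) (tilings zero t)
tilings (suc (suc N)) zero    = map (mono ∷_) (tilings (suc N) zero)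
tilings (suc (suc N)) (suc t) = map (mono ∷_) (tilings (suc N) (suc t)) ++ map (domino ∷_) (tilings N t)

∈-tilings⁺ : ∀ w → w ∈ tilings (cells w) (dominoes w)
∈-tilings⁺ []           = here refl
∈-tilings⁺ (mono ∷ w)   with cells w | dominoes w | ∈-tilings⁺ w
... | zero  | _     | w∈ = ∈-map⁺ (mono ∷_) w∈
... | suc _ | zero  | w∈ = ∈-map⁺ (mono ∷_) w∈
... | suc _ | suc _ | w∈ = ∈-++⁺ˡ (∈-map⁺ (mono ∷_) w∈)
∈-tilings⁺ (domino ∷ w) =
  ∈-++⁺ʳ (map (mono ∷_) (tilings (suc (cells w)) (suc (dominoes w)))) (∈-map⁺ (domino ∷_) (∈-tilings⁺ w))

∈-tilings⁻ : ∀ N t {w} → w ∈ tilings N t → cells w ≡ N × dominoes w ≡ t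
∈-tilings⁻ zero zero (here refl) = refl , refl
∈-tilings⁻ (suc zero) t w∈ with ∈-map⁻ (mono ∷_) w∈
... | v , v∈ , refl = Product.map₁ (cong suc) (∈-tilings⁻ zero t v∈)
∈-tilings⁻ (suc (suc N)) zero w∈ with ∈-map⁻ (mono ∷_) w∈
... | v , v∈ , refl = Product.map₁ (cong suc) (∈-tilings⁻ (suc N) zero v∈)
∈-tilings⁻ (suc (suc N)) (suc t) w∈ with ∈-++⁻ (map (mono ∷_) (tilings (suc N) (suc t))) w∈
... | inj₁ w∈′ with ∈-map⁻ (mono ∷_) w∈′
...   | v , v∈ , refl = Product.map₁ (cong suc) (∈-tilings⁻ (suc N) (suc t) v∈)
∈-tilings⁻ (suc (suc N)) (suc t) w∈ | inj₂ w∈′ with ∈-map⁻ (domino ∷_) w∈′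
...   | v , v∈ , refl = Product.map (cong (λ (c : ℕ) → 2 + c)) (cong suc) (∈-tilings⁻ N t v∈)

tilings-unique : ∀ N t → Unique (tilings N t)
tilings-unique zero          zero    = [] ∷ []
tilings-unique zero          (suc t) = []
tilings-unique (suc zero)    t       = map⁺ ∷-injectiveʳ (tilings-unique zero t)
tilings-unique (suc (suc N)) zero    = map⁺ ∷-injectiveʳ (tilings-unique (suc N) zero)
tilings-unique (suc (suc N)) (suc t) =
  ++⁺ (map⁺ ∷-injectiveʳ (tilings-unique (suc N) (suc t))) (map⁺ ∷-injectiveʳ (tilings-unique N t)) disjoint
  where
  disjoint : ∀ {v} → ¬ (v ∈ map (mono ∷_) (tilings (suc N) (suc t)) × v ∈ map (domino ∷_) (tilings N t))
  disjoint (v∈ , v∈′) with ∈-map⁻ (mono ∷_) v∈ | ∈-map⁻ (domino ∷_) v∈′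
  ... | _ , _ , refl | _ , _ , ()

pascal-∸ : ∀ N t → (N ∸ t) C suc t + (N ∸ t) C t ≡ (suc N ∸ t) C suc t
pascal-∸ N t with t ≤? N
... | yes t≤N = trans (+-comm ((N ∸ t) C suc t) _)
  (trans (nCk+nC[k+1]≡[n+1]C[k+1] (N ∸ t) t) (cong (_C suc t) (sym (+-∸-assoc 1 t≤N))))
... | no t≰N rewrite m≤n⇒m∸n≡0 (<⇒≤ (≰⇒> t≰N)) | m≤n⇒m∸n≡0 (≰⇒> t≰N) =
  k>n⇒nCk≡0 (≤-<-trans z≤n (≰⇒> t≰N))

length-tilings : ∀ N t → length (tilings N t) ≡ (N ∸ t) C t
length-tilings zero          zero    = refl
length-tilings zero          (suc t) = refl
length-tilings (suc zero)    zero    = refl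
length-tilings (suc zero)    (suc t) rewrite 0∸n≡0 t = refl
length-tilings (suc (suc N)) zero    =
  trans (length-map (mono ∷_) (tilings (suc N) zero)) (length-tilings (suc N) zero)
length-tilings (suc (suc N)) (suc t) = begin
  length (map (mono ∷_) (tilings (suc N) (suc t)) ++ map (domino ∷_) (tilings N t))
    ≡⟨ length-++ (map (mono ∷_) (tilings (suc N) (suc t))) ⟩
  length (map (mono ∷_) (tilings (suc N) (suc t))) + length (map (domino ∷_) (tilings N t))
    ≡⟨ cong₂ _+_ (length-map (mono ∷_) (tilings (suc N) (suc t))) (length-map (domino ∷_) (tilings N t)) ⟩
  length (tilings (suc N) (suc t)) + length (tilings N t)
    ≡⟨ cong₂ _+_ (length-tilings (suc N) (suc t)) (length-tilings N t) ⟩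
  (N ∸ t) C suc t + (N ∸ t) C t
    ≡⟨ pascal-∸ N t ⟩
  (suc N ∸ t) C suc t
    ∎
  where open ≡-Reasoning

tiling-injective : ∀ o {w w′} → tiling o w ≡ tiling o w′ → w ≡ w′
tiling-injective o {[]}         {[]}          _  = refl
tiling-injective o {mono ∷ w}   {mono ∷ w′}   eq = cong (mono ∷_) (tiling-injective (suc o) (∷-injectiveʳ eq))
tiling-injective o {domino ∷ w} {domino ∷ w′} eq =
  cong (domino ∷_) (tiling-injective (suc (suc o)) (∷-injectiveʳ (∷-injectiveʳ eq)))
tiling-injective o {[]}         {mono ∷ _}    ()
tiling-injective o {[]}         {domino ∷ _}  ()
tiling-injective o {mono ∷ _}   {[]}          ()
tiling-injective o {mono ∷ _}   {domino ∷ _}  ()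
tiling-injective o {domino ∷ _} {[]}          ()
tiling-injective o {domino ∷ _} {mono ∷ _}    ()

splitAtZero : List ℕ → ℕ × List ℕ
splitAtZero []          = 0 , []
splitAtZero (zero ∷ r)  = 0 , r
splitAtZero (suc _ ∷ r) = Product.map₁ suc (splitAtZero r)

splitAtZero-block : ∀ a j r → splitAtZero (ascending (suc a) j ++ 0 ∷ r) ≡ (j , r)
splitAtZero-block a zero    r = refl
splitAtZero-block a (suc j) r = cong (Product.map₁ suc) (splitAtZero-block (suc a) j r)

canonical-injective : ∀ {s s′ : ℕ × List Tile} → uncurry canonical s ≡ uncurry canonical s′ → s ≡ s′
canonical-injective {j , w} {j′ , w′} eq =
  pair-injective (trans (sym (splitAtZero-block 0 j _)) (trans (cong splitAtZero eq) (splitAtZero-block 0 j′ _)))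
  where
  pair-injective : (j , tiling (suc j) w) ≡ (j′ , tiling (suc j′) w′) → (j , w) ≡ (j′ , w′)
  pair-injective split≡ with refl ← ,-injectiveˡ split≡ =
    cong (j ,_) (tiling-injective (suc j) (,-injectiveʳ split≡))

module _ {A : Set} (G : ℕ → List A) where

  pairsOver : List ℕ → List (ℕ × A)
  pairsOver []       = []
  pairsOver (i ∷ is) = map (i ,_) (G i) ++ pairsOver is

  ∈-pairsOver⁺ : ∀ {is i x} → i ∈ is → x ∈ G i → (i , x) ∈ pairsOver is
  ∈-pairsOver⁺ {i ∷ is} (here refl) x∈ = ∈-++⁺ˡ (∈-map⁺ (i ,_) x∈)
  ∈-pairsOver⁺ {j ∷ is} (there i∈)  x∈ = ∈-++⁺ʳ (map (j ,_) (G j)) (∈-pairsOver⁺ i∈ x∈)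

  ∈-pairsOver⁻ : ∀ is {i x} → (i , x) ∈ pairsOver is → i ∈ is × x ∈ G i
  ∈-pairsOver⁻ (j ∷ is) ix∈ with ∈-++⁻ (map (j ,_) (G j)) ix∈
  ... | inj₁ ix∈′ with ∈-map⁻ (j ,_) ix∈′
  ...   | _ , x∈ , refl = here refl , x∈
  ∈-pairsOver⁻ (j ∷ is) ix∈ | inj₂ ix∈′ = Product.map₁ there (∈-pairsOver⁻ is ix∈′)

  pairsOver-unique : (∀ i → Unique (G i)) → ∀ {is} → Unique is → Unique (pairsOver is)
  pairsOver-unique G-unique {[]}     []          = []
  pairsOver-unique G-unique {j ∷ is} (j∉is ∷ u) =
    ++⁺ (map⁺ ,-injectiveʳ (G-unique j)) (pairsOver-unique G-unique u) disjoint
    where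
    disjoint : ∀ {v} → ¬ (v ∈ map (j ,_) (G j) × v ∈ pairsOver is)
    disjoint (v∈ , v∈′) with ∈-map⁻ (j ,_) v∈
    ... | _ , _ , refl = All.lookup j∉is (proj₁ (∈-pairsOver⁻ is v∈′)) refl

  length-pairsOver : ∀ is → length (pairsOver is) ≡ sum (map (length ∘ G) is)
  length-pairsOver []       = refl
  length-pairsOver (j ∷ is) =
    trans (length-++ (map (j ,_) (G j))) (cong₂ _+_ (length-map (j ,_) (G j)) (length-pairsOver is))

HasCount-image : ∀ {A : Set} {P : List ℕ → Set} (f : A → List ℕ) → (∀ {a b} → f a ≡ f b → a ≡ b) →
  (xs : List A) → Unique xs → (∀ π → P π ⇔ ∃ λ a → a ∈ xs × π ≡ f a) → HasCount P (length xs)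
HasCount-image f f-injective xs u P⇔image = map f xs , map⁺ f-injective u , ∈⇔P , length-map f xs
  where
  ∈⇔P : ∀ π → π ∈ map f xs ⇔ _
  ∈⇔P π = mk⇔ (Equivalence.from (P⇔image π) ∘ ∈-map⁻ f)
    λ Pπ → case Equivalence.to (P⇔image π) Pπ of λ { (a , a∈ , refl) → ∈-map⁺ f a∈ }

+≡⇒≡∸ : ∀ m {x n} → m + x ≡ n → x ≡ n ∸ m
+≡⇒≡∸ m {x} m+x≡n = trans (sym (m+n∸m≡n m x)) (cong (_∸ m) m+x≡n)

-- The tilings that complete canonical j _ to a permutation of length n with k inversions.
tilingsAfter : ℕ → ℕ → ℕ → List (List Tile)
tilingsAfter n k j with j ≤? k
... | yes _ = tilings (n ∸ suc j) (k ∸ j)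
... | no  _ = []

∈-tilingsAfter⁻ : ∀ {n k j w} → j < n → w ∈ tilingsAfter n k j → suc j + cells w ≡ n × j + dominoes w ≡ k
∈-tilingsAfter⁻ {n} {k} {j} j<n w∈ with j ≤? k
... | yes j≤k with cells≡ , dominoes≡ ← ∈-tilings⁻ (n ∸ suc j) (k ∸ j) w∈ =
  trans (cong (λ c → suc j + c) cells≡) (m+[n∸m]≡n j<n) , trans (cong (λ d → j + d) dominoes≡) (m+[n∸m]≡n j≤k)

∈-tilingsAfter⁺ : ∀ {n k j w} → suc j + cells w ≡ n → j + dominoes w ≡ k → w ∈ tilingsAfter n k j
∈-tilingsAfter⁺ {n} {k} {j} {w} length≡ inv≡ with j ≤? k
... | yes _  = subst₂ (λ N t → w ∈ tilings N t) (+≡⇒≡∸ (suc j) length≡) (+≡⇒≡∸ j inv≡) (∈-tilings⁺ w)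
... | no j≰k = ⊥-elim (j≰k (subst (j ≤_) inv≡ (m≤m+n j (dominoes w))))

tilingsAfter-unique : ∀ n k j → Unique (tilingsAfter n k j)
tilingsAfter-unique n k j with j ≤? k
... | yes _ = tilings-unique (n ∸ suc j) (k ∸ j)
... | no  _ = []

shapes : ℕ → ℕ → List (ℕ × List Tile)
shapes n k = pairsOver (tilingsAfter n k) (upTo n)

avoider⇔shape : ∀ {n k} → 1 ≤ n → ∀ π →
  (IsPerm n π × Avoids π B₂ × inv π ≡ k) ⇔ ∃ λ s → s ∈ shapes n k × π ≡ uncurry canonical s
avoider⇔shape {n} {k} 1≤n π = mk⇔ to from
  where
  to : IsPerm n π × Avoids π B₂ × inv π ≡ k → ∃ λ s → s ∈ shapes n k × π ≡ uncurry canonical s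
  to (π↭ , avoids , inv≡) with avoider⇒canonical 1≤n π↭ avoids
  ... | j , w , refl = (j , w) , ∈-pairsOver⁺ (tilingsAfter n k) (∈-upTo⁺ j<n) w∈ , refl
    where
    length≡ : suc j + cells w ≡ n
    length≡ = trans (sym (length-canonical j w)) (trans (↭-length π↭) (length-upTo n))
    j<n : j < n
    j<n = subst (suc j ≤_) length≡ (m≤m+n (suc j) (cells w))
    w∈ : w ∈ tilingsAfter n k j
    w∈ = ∈-tilingsAfter⁺ length≡ (trans (sym (inv-canonical j w)) inv≡)
  from : ∃ (λ s → s ∈ shapes n k × π ≡ uncurry canonical s) → IsPerm n π × Avoids π B₂ × inv π ≡ k
  from ((j , w) , s∈ , refl) with ∈-pairsOver⁻ (tilingsAfter n k) (upTo n) s∈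
  ... | j∈ , w∈ with ∈-tilingsAfter⁻ (∈-upTo⁻ j∈) w∈
  ... | length≡ , inv≡ =
    subst (λ m → canonical j w ↭ upTo m) length≡ (canonical-↭ j w) ,
    canonical-avoids j w ,
    trans (inv-canonical j w) inv≡

+-sub-nonneg : ∀ {a b} → b ≤ a → + a - + b ≡ + (a ∸ b)
+-sub-nonneg {a} {b} b≤a = trans (m-n≡m⊖n a b) (⊖-≥ b≤a)

+-sub-neg : ∀ {a b} → a < b → + a - + b ≡ -[1+ b ∸ suc a ]
+-sub-neg {a} {b} a<b = trans (m-n≡m⊖n a b) (trans (⊖-< a<b) (cong (λ d → - (+ d)) (+-∸-assoc 1 a<b)))

binomℤ-negʳ : ∀ x {a b} → a < b → binomℤ x (+ a - + b) ≡ 0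
binomℤ-negʳ x a<b = trans (cong (binomℤ x) (+-sub-neg a<b)) (binomℤ-[1+] x)
  where
  binomℤ-[1+] : ∀ x {y} → binomℤ x -[1+ y ] ≡ 0
  binomℤ-[1+] (+ _)    = refl
  binomℤ-[1+] -[1+ _ ] = refl

-- When b > a the left side is 0 by definition and the right side 0 C m, which vanishes only for m > 0.
binomℤ-sub : ∀ {a b m} → b ≤ a ⊎ 0 < m → binomℤ (+ a - + b) (+ m) ≡ (a ∸ b) C m
binomℤ-sub {a} {b} {m} (inj₁ b≤a) = cong (λ x → binomℤ x (+ m)) (+-sub-nonneg b≤a)
binomℤ-sub {a} {b} {m} (inj₂ 0<m) with b ≤? a
... | yes b≤a = binomℤ-sub (inj₁ b≤a)
... | no  b≰a = begin
  binomℤ (+ a - + b) (+ m)   ≡⟨ cong (λ x → binomℤ x (+ m)) (+-sub-neg (≰⇒> b≰a)) ⟩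
  0                          ≡⟨ k>n⇒nCk≡0 0<m ⟨
  0 C m                      ≡⟨ cong (_C m) (m≤n⇒m∸n≡0 (<⇒≤ (≰⇒> b≰a))) ⟨
  (a ∸ b) C m                ∎
  where open ≡-Reasoning

-- The term ℓ = i + 1 of the sum in the statement.
summand : ℕ → ℕ → ℕ → ℕ
summand n k i = binomℤ ((+ n - + k) - + 1) ((+ k - + (suc i)) +ℤ + 1)

summand≡ : ∀ n k j → summand n k j ≡ binomℤ (+ n - + suc k) (+ k - + j)
summand≡ n k j = cong₂ binomℤ (upper (+ n) (+ k)) (lower (+ k) (+ j))
  where
  upper : ∀ (a b : ℤ) → (a - b) - ℤ.1ℤ ≡ a - (ℤ.1ℤ +ℤ b)
  upper = solve-∀
  lower : ∀ (a b : ℤ) → (a - (ℤ.1ℤ +ℤ b)) +ℤ ℤ.1ℤ ≡ a - b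
  lower = solve-∀

length-tilingsAfter : ∀ {n k j} → j < n → length (tilingsAfter n k j) ≡ summand n k j
length-tilingsAfter {n} {k} {j} j<n with j ≤? k
... | no j≰k  = sym (trans (summand≡ n k j) (binomℤ-negʳ (+ n - + suc k) (≰⇒> j≰k)))
... | yes j≤k = begin
  length (tilings (n ∸ suc j) (k ∸ j))   ≡⟨ length-tilings (n ∸ suc j) (k ∸ j) ⟩
  ((n ∸ suc j) ∸ (k ∸ j)) C (k ∸ j)       ≡⟨ cong (_C (k ∸ j)) upper≡ ⟩
  (n ∸ suc k) C (k ∸ j)                   ≡⟨ binomℤ-sub side-condition ⟨
  binomℤ (+ n - + suc k) (+ (k ∸ j))      ≡⟨ cong (binomℤ (+ n - + suc k)) (+-sub-nonneg j≤k) ⟨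
  binomℤ (+ n - + suc k) (+ k - + j)      ≡⟨ summand≡ n k j ⟨
  summand n k j                           ∎
  where
  open ≡-Reasoning
  upper≡ : (n ∸ suc j) ∸ (k ∸ j) ≡ n ∸ suc k
  upper≡ = trans (∸-+-assoc n (suc j) (k ∸ j)) (cong (λ m → n ∸ suc m) (m+[n∸m]≡n j≤k))
  side-condition : suc k ≤ n ⊎ 0 < k ∸ j
  side-condition with suc k ≤? n
  ... | yes sk≤n = inj₁ sk≤n
  ... | no  sk≰n = inj₂ (m<n⇒0<n∸m (<-≤-trans j<n (m<1+n⇒m≤n (≰⇒> sk≰n))))

length-shapes : ∀ n k → length (shapes n k) ≡ sum (map (summand n k) (upTo n))
length-shapes n k = trans (length-pairsOver (tilingsAfter n k) (upTo n))
  (cong sum (map-cong-local (All.tabulate (length-tilingsAfter {n} {k} ∘ ∈-upTo⁻))))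

theorem3p4 : (n k : ℕ) → 1 ≤ n →
    HasCount (λ π → IsPerm n π × Avoids π B₂ × inv π ≡ k)
      (sum (map (λ i → binomℤ ((+ n - + k) - + 1) ((+ k - + (suc i)) +ℤ + 1)) (upTo n)))
theorem3p4 n k 1≤n = subst (HasCount _) (length-shapes n k)
  (HasCount-image (uncurry canonical) canonical-injective (shapes n k)
    (pairsOver-unique (tilingsAfter n k) (tilingsAfter-unique n k) (upTo⁺ n)) (avoider⇔shape 1≤n))
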